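{- In each of the logics IPL, S4.3 and GL: (i) $\wedge$ and $\vee$ are binary constructors with identities for position 1 and pairwise formula completion for position 2, and they also have identities for position 2 and pairwise formula completion for position 1; (ii) $\to$ is a binary constructor with identities for position 2 and pairwise formula completion for position 1.
   Context: The formulas of IPL (intuitionistic propositional logic) are built from schema variables and the constants $\top,\bot$ using $\neg$ and $\wedge,\vee,\to,\leftrightarrow$; for S4.3 and GL (Gödel–Löb logic) one additionally has $\Box$. $\vdash$ denotes theoremhood; $\leftrightarrow$ is the equivalence connective. The decomposition tree $t(\varphi)$ is the rooted tree whose vertices are the subformula occurrences of $\varphi$, with an edge from $c(\varphi_1,\dots,\varphi_m)$ to each $\varphi_i$. An embedding of tree $t_1$ into tree $t_2$ is a pair of injective maps on vertices and on edges preserving sources and targets of edges and the outdegree of sources; $t(\varphi_1)\approx t(\varphi_2)$ means each tree embeds into the other. An $n$-ary constructor $c$ ($n\ge2$) has identities for position $k$ if there are constants $o_1,\dots,o_{k-1},o_{k+1},\dots,o_n$ (nullary constructors) with $\vdash c(o_1,\dots,o_{k-1},\varphi,o_{k+1},\dots,o_n)\leftrightarrow\varphi$ for every formula $\varphi$; such $c$ has pairwise formula completion for position $j\ne k$ if for every formula $\psi$ there is a formula $\delta$ with $\vdash o_j\leftrightarrow\delta$ and $t(\delta)\approx t(\psi)$. -}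

module Defs where

open import Data.Nat using (ℕ)
open import Data.Fin using (Fin)
open import Data.List using (List; []; _∷_; length; lookup)
open import Data.Unit using (⊤; tt)
open import Data.Empty renaming (⊥ to Empty)
open import Data.Product using (Σ; _×_; _,_; proj₁)
open import Relation.Binary.PropositionalEquality using (_≡_)
open import Function.Definitions using (Injective)

data Logic : Set where
  IPL S4·3 GL : Logic

Modal : Logic → Set
Modal IPL  = Empty
Modal S4·3 = ⊤
Modal GL   = ⊤

Classical : Logic → Set
Classical IPL  = Empty
Classical S4·3 = ⊤
Classical GL   = ⊤

infixr 6 _∧'_ _∨'_
infixr 5 _⇒_
infix  4 _⇔_

data Fm (L : Logic) : Set where
  var  : ℕ → Fm L
  ⊤'   : Fm L
  ⊥'   : Fm L
  ¬'_  : Fm L → Fm L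
  _∧'_ : Fm L → Fm L → Fm L
  _∨'_ : Fm L → Fm L → Fm L
  _⇒_  : Fm L → Fm L → Fm L
  _⇔_  : Fm L → Fm L → Fm L
  □    : Modal L → Fm L → Fm L

data Thm : (L : Logic) → Fm L → Set where
  ax-K   : ∀ {L} {A B : Fm L} → Thm L (A ⇒ (B ⇒ A))
  ax-S   : ∀ {L} {A B C : Fm L} → Thm L ((A ⇒ (B ⇒ C)) ⇒ ((A ⇒ B) ⇒ (A ⇒ C)))
  ax-∧₁  : ∀ {L} {A B : Fm L} → Thm L ((A ∧' B) ⇒ A)
  ax-∧₂  : ∀ {L} {A B : Fm L} → Thm L ((A ∧' B) ⇒ B)
  ax-∧I  : ∀ {L} {A B : Fm L} → Thm L (A ⇒ (B ⇒ (A ∧' B)))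
  ax-∨₁  : ∀ {L} {A B : Fm L} → Thm L (A ⇒ (A ∨' B))
  ax-∨₂  : ∀ {L} {A B : Fm L} → Thm L (B ⇒ (A ∨' B))
  ax-∨E  : ∀ {L} {A B C : Fm L} → Thm L ((A ⇒ C) ⇒ ((B ⇒ C) ⇒ ((A ∨' B) ⇒ C)))
  ax-⊥   : ∀ {L} {A : Fm L} → Thm L (⊥' ⇒ A)
  ax-⊤   : ∀ {L} → Thm L ⊤'
  ax-¬₁  : ∀ {L} {A : Fm L} → Thm L ((¬' A) ⇒ (A ⇒ ⊥'))
  ax-¬₂  : ∀ {L} {A : Fm L} → Thm L ((A ⇒ ⊥') ⇒ (¬' A))
  ax-⇔₁  : ∀ {L} {A B : Fm L} → Thm L ((A ⇔ B) ⇒ (A ⇒ B))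
  ax-⇔₂  : ∀ {L} {A B : Fm L} → Thm L ((A ⇔ B) ⇒ (B ⇒ A))
  ax-⇔I  : ∀ {L} {A B : Fm L} → Thm L ((A ⇒ B) ⇒ ((B ⇒ A) ⇒ (A ⇔ B)))
  mp     : ∀ {L} {A B : Fm L} → Thm L (A ⇒ B) → Thm L A → Thm L B
  ax-dne : ∀ {L} {A : Fm L} → Classical L → Thm L ((¬' (¬' A)) ⇒ A)
  ax-□K  : ∀ {L} {A B : Fm L} (m : Modal L) → Thm L (□ m (A ⇒ B) ⇒ (□ m A ⇒ □ m B))
  nec    : ∀ {L} {A : Fm L} (m : Modal L) → Thm L A → Thm L (□ m A)
  ax-T   : ∀ {A : Fm S4·3} → Thm S4·3 (□ tt A ⇒ A)
  ax-4   : ∀ {A : Fm S4·3} → Thm S4·3 (□ tt A ⇒ □ tt (□ tt A))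
  ax-·3  : ∀ {A B : Fm S4·3} →
           Thm S4·3 (□ tt (□ tt A ⇒ B) ∨' □ tt (□ tt B ⇒ A))
  ax-Löb : ∀ {A : Fm GL} → Thm GL (□ tt (□ tt A ⇒ A) ⇒ □ tt A)

children : ∀ {L} → Fm L → List (Fm L)
children (var _)   = []
children ⊤'        = []
children ⊥'        = []
children (¬' A)    = A ∷ []
children (A ∧' B)  = A ∷ B ∷ []
children (A ∨' B)  = A ∷ B ∷ []
children (A ⇒ B)   = A ∷ B ∷ []
children (A ⇔ B)   = A ∷ B ∷ []
children (□ _ A)   = A ∷ []

-- Vertices of t(φ): paths from the root to a subformula occurrence.
data Vertex {L : Logic} : Fm L → Set where
  here : ∀ {φ} → Vertex φ
  down : ∀ {φ} (i : Fin (length (children φ))) →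
         Vertex (lookup (children φ) i) → Vertex φ

sub : ∀ {L} {φ : Fm L} → Vertex φ → Fm L
sub {φ = φ} here = φ
sub (down i v) = sub v

outdeg : ∀ {L} {φ : Fm L} → Vertex φ → ℕ
outdeg v = length (children (sub v))

child : ∀ {L} {φ : Fm L} (v : Vertex φ) → Fin (outdeg v) → Vertex φ
child here       i = down i here
child (down j v) i = down j (child v i)

Edge : ∀ {L} → Fm L → Set
Edge φ = Σ (Vertex φ) (λ v → Fin (outdeg v))

src : ∀ {L} {φ : Fm L} → Edge φ → Vertex φ
src (v , _) = v

tgt : ∀ {L} {φ : Fm L} → Edge φ → Vertex φ
tgt (v , i) = child v i

Embeds : ∀ {L} → Fm L → Fm L → Set
Embeds φ₁ φ₂ =
  Σ (Vertex φ₁ → Vertex φ₂) λ f →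
  Σ (Edge φ₁ → Edge φ₂) λ g →
    Injective _≡_ _≡_ f × Injective _≡_ _≡_ g
  × (∀ e → src (g e) ≡ f (src e))
  × (∀ e → tgt (g e) ≡ f (tgt e))
  × (∀ e → outdeg (src (g e)) ≡ outdeg (src e))

_≈t_ : ∀ {L} → Fm L → Fm L → Set
φ₁ ≈t φ₂ = Embeds φ₁ φ₂ × Embeds φ₂ φ₁

data Const : Set where
  c⊤ c⊥ : Const

const : ∀ {L} → Const → Fm L
const c⊤ = ⊤'
const c⊥ = ⊥'

data BinCon : Set where
  and or imp : BinCon

apply : ∀ {L} → BinCon → Fm L → Fm L → Fm L
apply and A B = A ∧' B
apply or  A B = A ∨' B
apply imp A B = A ⇒ B

data Position : Set where
  pos1 pos2 : Position

applyAt : ∀ {L} → BinCon → Position → Fm L → Const → Fm L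
applyAt c pos1 φ o = apply c φ (const o)
applyAt c pos2 φ o = apply c (const o) φ

-- In logic L, the binary constructor c has identities for position k
-- (witnessed by the constant o at the other position j ≠ k) and
-- pairwise formula completion for that position j (w.r.t. the same o).
IdentitiesAndCompletion : (L : Logic) → BinCon → Position → Set
IdentitiesAndCompletion L c k =
  Σ Const λ o →
    (∀ (φ : Fm L) → Thm L (applyAt c k φ o ⇔ φ))
  × (∀ (ψ : Fm L) → Σ (Fm L) λ δ → Thm L (const o ⇔ δ) × (δ ≈t ψ))

-- For completion, every
-- ψ has a provable and a refutable formula of the same shape, built together
-- by recursion: leaves become ⊤ (resp. ⊥), ¬ swaps the two, and the refutable
-- formula for A → B or A ↔ B uses the provable one for A. □ is renamed to ¬,
-- since □ψ′ need not be refutable (in GL) while ¬ψ′ is refutable for provable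
-- ψ′. Formulas of the same shape have isomorphic decomposition trees.
module Submission where

open import Defs
open import Data.Fin using (Fin; zero; suc)
open import Data.List using (List; _∷_; length; lookup)
open import Data.List.Relation.Binary.Pointwise using (Pointwise; []; _∷_; Pointwise-length)
open import Data.Maybe using (Maybe; just; nothing; maybe)
open import Data.Maybe.Properties using (just-injective)
open import Data.Product using (Σ; _×_; _,_; proj₁; proj₂)
open import Function.Definitions using (Injective)
open import Relation.Binary.PropositionalEquality
  using (_≡_; refl; sym; cong; module ≡-Reasoning)

module _ {L : Logic} where

  ⇒-refl : {A : Fm L} → Thm L (A ⇒ A)
  ⇒-refl {A} = mp (mp (ax-S {B = A ⇒ A}) ax-K) ax-K

  ⇒-trans : {A B C : Fm L} → Thm L (A ⇒ B) → Thm L (B ⇒ C) → Thm L (A ⇒ C)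
  ⇒-trans ab bc = mp (mp ax-S (mp ax-K bc)) ab

  mp-inner : {A B C : Fm L} → Thm L (A ⇒ (B ⇒ C)) → Thm L B → Thm L (A ⇒ C)
  mp-inner abc b = mp (mp ax-S abc) (mp ax-K b)

  ⇔-intro : {A B : Fm L} → Thm L (A ⇒ B) → Thm L (B ⇒ A) → Thm L (A ⇔ B)
  ⇔-intro ab ba = mp (mp ax-⇔I ab) ba

  ∧-identityˡ : (φ : Fm L) → Thm L (⊤' ∧' φ ⇔ φ)
  ∧-identityˡ φ = ⇔-intro ax-∧₂ (mp ax-∧I ax-⊤)

  ∧-identityʳ : (φ : Fm L) → Thm L (φ ∧' ⊤' ⇔ φ)
  ∧-identityʳ φ = ⇔-intro ax-∧₁ (mp-inner ax-∧I ax-⊤)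

  ∨-identityˡ : (φ : Fm L) → Thm L (⊥' ∨' φ ⇔ φ)
  ∨-identityˡ φ = ⇔-intro (mp (mp ax-∨E ax-⊥) ⇒-refl) ax-∨₂

  ∨-identityʳ : (φ : Fm L) → Thm L (φ ∨' ⊥' ⇔ φ)
  ∨-identityʳ φ = ⇔-intro (mp (mp ax-∨E ⇒-refl) ax-⊥) ax-∨₁

  ⇒-identityˡ : (φ : Fm L) → Thm L ((⊤' ⇒ φ) ⇔ φ)
  ⇒-identityˡ φ = ⇔-intro (mp-inner ⇒-refl ax-⊤) ax-K

  -- Edges are recovered from their targets through the parent map.
  parent : {φ : Fm L} → Vertex φ → Maybe (Edge φ)
  parent here       = nothing
  parent (down i v) = maybe (λ { (w , k) → just (down i w , k) }) (just (here , i)) (parent v)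

  parent-child : {φ : Fm L} (v : Vertex φ) (i : Fin (outdeg v)) → parent (child v i) ≡ just (v , i)
  parent-child here       i = refl
  parent-child (down j v) i rewrite parent-child v i = refl

  tgt-injective : {φ : Fm L} → Injective _≡_ _≡_ (tgt {φ = φ})
  tgt-injective {x = v , i} {y = w , k} eq = just-injective (begin
    just (v , i)          ≡⟨ sym (parent-child v i) ⟩
    parent (child v i)    ≡⟨ cong parent eq ⟩
    parent (child w k)    ≡⟨ parent-child w k ⟩
    just (w , k)          ∎)
    where open ≡-Reasoning

  infix 4 _∼_

  data _∼_ : Fm L → Fm L → Set where
    node : {a b : Fm L} → Pointwise _∼_ (children a) (children b) → a ∼ b

  Branch : List (Fm L) → Set
  Branch xs = Σ (Fin (length xs)) λ i → Vertex (lookup xs i)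

  down′ : {φ : Fm L} → Branch (children φ) → Vertex φ
  down′ (i , v) = down i v

  there : {x : Fm L} {xs : List (Fm L)} → Branch xs → Branch (x ∷ xs)
  there (i , v) = suc i , v

  reindex : {xs ys : List (Fm L)} → Pointwise _∼_ xs ys → Fin (length xs) → Fin (length ys)
  reindex (_ ∷ _)  zero    = zero
  reindex (_ ∷ rs) (suc i) = suc (reindex rs i)

  mutual
    ∼-sym : {a b : Fm L} → a ∼ b → b ∼ a
    ∼-sym (node rs) = node (∼*-sym rs)

    ∼*-sym : {xs ys : List (Fm L)} → Pointwise _∼_ xs ys → Pointwise _∼_ ys xs
    ∼*-sym []       = []
    ∼*-sym (r ∷ rs) = ∼-sym r ∷ ∼*-sym rs

  mutual
    vertex : {a b : Fm L} → a ∼ b → Vertex a → Vertex b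
    vertex _         here       = here
    vertex (node rs) (down i v) = down′ (branch rs (i , v))

    branch : {xs ys : List (Fm L)} → Pointwise _∼_ xs ys → Branch xs → Branch ys
    branch (r ∷ _)  (zero  , v) = zero , vertex r v
    branch (_ ∷ rs) (suc i , v) = there (branch rs (i , v))

  mutual
    arity : {a b : Fm L} (s : a ∼ b) (v : Vertex a) → Fin (outdeg v) → Fin (outdeg (vertex s v))
    arity (node rs) here       = reindex rs
    arity (node rs) (down i v) = branch-arity rs (i , v)

    branch-arity : {xs ys : List (Fm L)} (rs : Pointwise _∼_ xs ys) (p : Branch xs) →
                   Fin (outdeg (proj₂ p)) → Fin (outdeg (proj₂ (branch rs p)))
    branch-arity (r ∷ _)  (zero  , v) = arity r v
    branch-arity (_ ∷ rs) (suc i , v) = branch-arity rs (i , v)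

  edge : {a b : Fm L} → a ∼ b → Edge a → Edge b
  edge s (v , i) = vertex s v , arity s v i

  mutual
    vertex-inverse : {a b : Fm L} (s : a ∼ b) (v : Vertex a) → vertex (∼-sym s) (vertex s v) ≡ v
    vertex-inverse _         here       = refl
    vertex-inverse (node rs) (down i v) = cong down′ (branch-inverse rs (i , v))

    branch-inverse : {xs ys : List (Fm L)} (rs : Pointwise _∼_ xs ys) (p : Branch xs) →
                     branch (∼*-sym rs) (branch rs p) ≡ p
    branch-inverse (r ∷ _)  (zero  , v) = cong (zero ,_) (vertex-inverse r v)
    branch-inverse (_ ∷ rs) (suc i , v) = cong there (branch-inverse rs (i , v))

  vertex-injective : {a b : Fm L} (s : a ∼ b) → Injective _≡_ _≡_ (vertex s)
  vertex-injective s {v} {w} eq = begin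
    v                                 ≡⟨ sym (vertex-inverse s v) ⟩
    vertex (∼-sym s) (vertex s v)     ≡⟨ cong (vertex (∼-sym s)) eq ⟩
    vertex (∼-sym s) (vertex s w)     ≡⟨ vertex-inverse s w ⟩
    w                                 ∎
    where open ≡-Reasoning

  branch-root : {xs ys : List (Fm L)} (rs : Pointwise _∼_ xs ys) (i : Fin (length xs)) →
                branch rs (i , here) ≡ (reindex rs i , here)
  branch-root (_ ∷ _)  zero    = refl
  branch-root (_ ∷ rs) (suc i) = cong there (branch-root rs i)

  mutual
    vertex-child : {a b : Fm L} (s : a ∼ b) (v : Vertex a) (i : Fin (outdeg v)) →
                   child (vertex s v) (arity s v i) ≡ vertex s (child v i)
    vertex-child (node rs) here       i = sym (cong down′ (branch-root rs i))
    vertex-child (node rs) (down j v) i = cong down′ (branch-child rs (j , v) i)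

    branch-child : {xs ys : List (Fm L)} (rs : Pointwise _∼_ xs ys) (p : Branch xs) (i : Fin (outdeg (proj₂ p))) →
                   (proj₁ (branch rs p) , child (proj₂ (branch rs p)) (branch-arity rs p i))
                     ≡ branch rs (proj₁ p , child (proj₂ p) i)
    branch-child (r ∷ _)  (zero  , v) i = cong (zero ,_) (vertex-child r v i)
    branch-child (_ ∷ rs) (suc j , v) i = cong there (branch-child rs (j , v) i)

  mutual
    outdeg-vertex : {a b : Fm L} (s : a ∼ b) (v : Vertex a) → outdeg (vertex s v) ≡ outdeg v
    outdeg-vertex (node rs) here       = sym (Pointwise-length rs)
    outdeg-vertex (node rs) (down i v) = outdeg-branch rs (i , v)

    outdeg-branch : {xs ys : List (Fm L)} (rs : Pointwise _∼_ xs ys) (p : Branch xs) →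
                    outdeg (proj₂ (branch rs p)) ≡ outdeg (proj₂ p)
    outdeg-branch (r ∷ _)  (zero  , v) = outdeg-vertex r v
    outdeg-branch (_ ∷ rs) (suc i , v) = outdeg-branch rs (i , v)

  edge-injective : {a b : Fm L} (s : a ∼ b) → Injective _≡_ _≡_ (edge s)
  edge-injective s {v , i} {w , k} eq = tgt-injective (vertex-injective s (begin
    vertex s (child v i)                 ≡⟨ sym (vertex-child s v i) ⟩
    tgt (edge s (v , i))                 ≡⟨ cong tgt eq ⟩
    tgt (edge s (w , k))                 ≡⟨ vertex-child s w k ⟩
    vertex s (child w k)                 ∎))
    where open ≡-Reasoning

  ∼⇒embeds : {a b : Fm L} → a ∼ b → Embeds a b
  ∼⇒embeds s =
    vertex s , edge s , vertex-injective s , edge-injective s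
    , (λ _ → refl) , (λ { (v , i) → vertex-child s v i }) , (λ { (v , _) → outdeg-vertex s v })

  ∼⇒≈t : {a b : Fm L} → a ∼ b → a ≈t b
  ∼⇒≈t s = ∼⇒embeds s , ∼⇒embeds (∼-sym s)

  mutual
    provable-twin : Fm L → Fm L
    provable-twin (var _)  = ⊤'
    provable-twin ⊤'       = ⊤'
    provable-twin ⊥'       = ⊤'
    provable-twin (¬' A)   = ¬' refutable-twin A
    provable-twin (A ∧' B) = provable-twin A ∧' provable-twin B
    provable-twin (A ∨' B) = provable-twin A ∨' provable-twin B
    provable-twin (A ⇒ B)  = provable-twin A ⇒ provable-twin B
    provable-twin (A ⇔ B)  = provable-twin A ⇔ provable-twin B
    provable-twin (□ _ A)  = ¬' refutable-twin A

    refutable-twin : Fm L → Fm L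
    refutable-twin (var _)  = ⊥'
    refutable-twin ⊤'       = ⊥'
    refutable-twin ⊥'       = ⊥'
    refutable-twin (¬' A)   = ¬' provable-twin A
    refutable-twin (A ∧' B) = refutable-twin A ∧' refutable-twin B
    refutable-twin (A ∨' B) = refutable-twin A ∨' refutable-twin B
    refutable-twin (A ⇒ B)  = provable-twin A ⇒ refutable-twin B
    refutable-twin (A ⇔ B)  = provable-twin A ⇔ refutable-twin B
    refutable-twin (□ _ A)  = ¬' provable-twin A

  mutual
    provable-twin-thm : (A : Fm L) → Thm L (provable-twin A)
    provable-twin-thm (var _)  = ax-⊤
    provable-twin-thm ⊤'       = ax-⊤
    provable-twin-thm ⊥'       = ax-⊤
    provable-twin-thm (¬' A)   = mp ax-¬₂ (refutable-twin-thm A)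
    provable-twin-thm (A ∧' B) = mp (mp ax-∧I (provable-twin-thm A)) (provable-twin-thm B)
    provable-twin-thm (A ∨' B) = mp ax-∨₁ (provable-twin-thm A)
    provable-twin-thm (A ⇒ B)  = mp ax-K (provable-twin-thm B)
    provable-twin-thm (A ⇔ B)  = ⇔-intro (mp ax-K (provable-twin-thm B)) (mp ax-K (provable-twin-thm A))
    provable-twin-thm (□ _ A)  = mp ax-¬₂ (refutable-twin-thm A)

    refutable-twin-thm : (A : Fm L) → Thm L (refutable-twin A ⇒ ⊥')
    refutable-twin-thm (var _)  = ⇒-refl
    refutable-twin-thm ⊤'       = ⇒-refl
    refutable-twin-thm ⊥'       = ⇒-refl
    refutable-twin-thm (¬' A)   = mp-inner ax-¬₁ (provable-twin-thm A)
    refutable-twin-thm (A ∧' B) = ⇒-trans ax-∧₁ (refutable-twin-thm A)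
    refutable-twin-thm (A ∨' B) = mp (mp ax-∨E (refutable-twin-thm A)) (refutable-twin-thm B)
    refutable-twin-thm (A ⇒ B)  = ⇒-trans (mp-inner ⇒-refl (provable-twin-thm A)) (refutable-twin-thm B)
    refutable-twin-thm (A ⇔ B)  = ⇒-trans (mp-inner ax-⇔₁ (provable-twin-thm A)) (refutable-twin-thm B)
    refutable-twin-thm (□ _ A)  = mp-inner ax-¬₁ (provable-twin-thm A)

  mutual
    provable-twin∼ : (A : Fm L) → provable-twin A ∼ A
    provable-twin∼ (var _)  = node []
    provable-twin∼ ⊤'       = node []
    provable-twin∼ ⊥'       = node []
    provable-twin∼ (¬' A)   = node (refutable-twin∼ A ∷ [])
    provable-twin∼ (A ∧' B) = node (provable-twin∼ A ∷ provable-twin∼ B ∷ [])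
    provable-twin∼ (A ∨' B) = node (provable-twin∼ A ∷ provable-twin∼ B ∷ [])
    provable-twin∼ (A ⇒ B)  = node (provable-twin∼ A ∷ provable-twin∼ B ∷ [])
    provable-twin∼ (A ⇔ B)  = node (provable-twin∼ A ∷ provable-twin∼ B ∷ [])
    provable-twin∼ (□ _ A)  = node (refutable-twin∼ A ∷ [])

    refutable-twin∼ : (A : Fm L) → refutable-twin A ∼ A
    refutable-twin∼ (var _)  = node []
    refutable-twin∼ ⊤'       = node []
    refutable-twin∼ ⊥'       = node []
    refutable-twin∼ (¬' A)   = node (provable-twin∼ A ∷ [])
    refutable-twin∼ (A ∧' B) = node (refutable-twin∼ A ∷ refutable-twin∼ B ∷ [])
    refutable-twin∼ (A ∨' B) = node (refutable-twin∼ A ∷ refutable-twin∼ B ∷ [])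
    refutable-twin∼ (A ⇒ B)  = node (provable-twin∼ A ∷ refutable-twin∼ B ∷ [])
    refutable-twin∼ (A ⇔ B)  = node (provable-twin∼ A ∷ refutable-twin∼ B ∷ [])
    refutable-twin∼ (□ _ A)  = node (provable-twin∼ A ∷ [])

  ⊤-completion : (ψ : Fm L) → Σ (Fm L) λ δ → Thm L (⊤' ⇔ δ) × (δ ≈t ψ)
  ⊤-completion ψ =
    provable-twin ψ , ⇔-intro (mp ax-K (provable-twin-thm ψ)) (mp ax-K ax-⊤) , ∼⇒≈t (provable-twin∼ ψ)

  ⊥-completion : (ψ : Fm L) → Σ (Fm L) λ δ → Thm L (⊥' ⇔ δ) × (δ ≈t ψ)
  ⊥-completion ψ =
    refutable-twin ψ , ⇔-intro ax-⊥ (refutable-twin-thm ψ) , ∼⇒≈t (refutable-twin∼ ψ)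

proposition3p11 : (L : Logic) →
    (IdentitiesAndCompletion L and pos1 × IdentitiesAndCompletion L and pos2)
    × (IdentitiesAndCompletion L or pos1 × IdentitiesAndCompletion L or pos2)
    × IdentitiesAndCompletion L imp pos2
proposition3p11 L =
    ((c⊤ , ∧-identityʳ , ⊤-completion) , (c⊤ , ∧-identityˡ , ⊤-completion))
  , ((c⊥ , ∨-identityʳ , ⊥-completion) , (c⊥ , ∨-identityˡ , ⊥-completion))
  , (c⊤ , ⇒-identityˡ , ⊤-completion)
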